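{- Assume the setting described in the context, fix integers $0 \le d < e \le \lambda_1$, and define $\varphi\colon \boldsymbol{S}_{(d,e)} \to \boldsymbol{S}_{(e,d)}$ by $\varphi(S,T) = (S'_{U(S,T)}, T'_{U(S,T)})$. Then $\varphi$ is injective.
   Context: Fix integers $N \ge n\ge 1$ and partitions $\rho=(\rho_1,\ldots,\rho_n)$, $\lambda=(\lambda_1,\ldots,\lambda_n)$ (weakly decreasing nonnegative integers) such that there is exactly one $r$ with $\lambda_r=\rho_r-1$ and $\lambda_i=\rho_i$ for $i\ne r$. Position $(i,j)$ means row $i$, column $j$. For an integer $d$, $\rho/d$ is the skew shape obtained from the Young diagram of $\rho$ by removing the first $d$ boxes of the first row (similarly $\lambda/e$). A skew SSYT is a filling of a skew shape with positive integers satisfying the "skew SSYT requirements": entries weakly increase along rows and strictly increase down columns. For $0\le d\le\rho_1$, $0\le e\le\lambda_1$, $\boldsymbol{S}_{(d,e)}$ is the set of pairs $(S,T)$ with $S$ a skew SSYT of shape $\rho/d$ and $T$ a skew SSYT of shape $\lambda/e$, both with entries in $\{1,\ldots,N-1\}$; $S_{i,j}$ denotes an entry. For $(S,T)\in\boldsymbol{S}_{(d,e)}$ with $d<e$ use the convention $T_{1,j}=0$ for $d<j\le e$, and a box with entry $0$ is regarded as missing. For a set $U$ of positions in $\rho/d$ containing $(r,\rho_r)$, $S'_U$ is obtained from $T$ by adding a box at $(r,\rho_r)$ with entry $S_{r,\rho_r}$ and replacing $T_{i,j}$ by $S_{i,j}$ for each $(i,j)\in U\setminus\{(r,\rho_r)\}$;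 $T'_U$ is obtained from $S$ by removing the box at $(r,\rho_r)$ and replacing $S_{i,j}$ by $T_{i,j}$ for each $(i,j)\in U\setminus\{(r,\rho_r)\}$. A sequence $\{(B_k,C_k)\}_{1\le k\le M}$ of pairs of positions in $\rho/d$ is a spanning tree for $(S,T)$ if, with $B_0=(r,\rho_r)$ and $U_K=\{B_0,\ldots,B_K\}$: (1) $B_k\in\rho/d\setminus U_{k-1}$ and $C_k\in U_{k-1}$ for each $k$; (2) $B_k$ and $C_k$ are adjacent ($C_k=B_k\pm(1,0)$ or $B_k\pm(0,1)$); (3) for each $k$, $S'_{U_{k-1}}$ and $T'_{U_{k-1}}$ are not both skew SSYT's, and $(B_k,C_k)$ is a pair of adjacent positions at which one or both of them fail the skew SSYT requirements; (4) it is maximal: there is no pair $(B_{M+1},C_{M+1})$ of adjacent positions at which $S'_{U_M}$ or $T'_{U_M}$ fails the skew SSYT requirements. The set $U_M=\{B_0,\ldots,B_M\}$ is independent of the choice of spanning tree and is denoted $U(S,T)$; moreover $(S'_{U(S,T)},T'_{U(S,T)})\in\boldsymbol{S}_{(e,d)}$, so $\varphi$ is well defined. -}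

module Defs where

open import Data.Nat using (ℕ; zero; suc; _≤_; _<_; _≤ᵇ_; _<ᵇ_; _≡ᵇ_)
open import Data.Bool using (Bool; true; false; _∧_; _∨_; not; if_then_else_; T)
open import Data.Fin using (Fin; toℕ)
open import Data.Vec using (Vec; lookup; []; _∷_)
open import Data.List as List using (List; []; _∷_; take; map; length)
open import Data.Bool.ListAction using (any)
open import Data.Product using (_×_; _,_; proj₁; proj₂)
open import Data.Sum using (_⊎_)
open import Relation.Binary.PropositionalEquality using (_≡_)
open import Relation.Nullary using (¬_)

-- Positions (row i, column j), 1-indexed.
Pos : Set
Pos = ℕ × ℕ

-- A filling assigns a number to every position; only the positions of the
-- relevant (skew) diagram matter.  Entry 0 is the "missing box" convention.
Filling : Set
Filling = Pos → ℕ

IsPartition : ∀ {n} → Vec ℕ n → Set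
IsPartition {n} μ = (i j : Fin n) → toℕ i ≤ toℕ j → lookup μ j ≤ lookup μ i

-- Length of row i (1-indexed); 0 for i = 0 or i > n.
row : ∀ {n} → Vec ℕ n → ℕ → ℕ
row μ zero = zero
row [] (suc i) = zero
row (x ∷ μ) (suc zero) = x
row (x ∷ μ) (suc (suc i)) = row μ (suc i)

-- Membership of a position in the skew shape μ/d
-- (Young diagram of μ with the first d boxes of the first row removed).
inSkew : ∀ {n} → Vec ℕ n → ℕ → Pos → Bool
inSkew μ d (i , j) =
  (1 ≤ᵇ i) ∧ (1 ≤ᵇ j) ∧ (j ≤ᵇ row μ i) ∧ (not (i ≡ᵇ 1) ∨ (d <ᵇ j))

InSkew : ∀ {n} → Vec ℕ n → ℕ → Pos → Set
InSkew μ d p = T (inSkew μ d p)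

right down : Pos → Pos
right (i , j) = (i , suc j)
down  (i , j) = (suc i , j)

IsSkewSSYT : ∀ {n} → ℕ → Vec ℕ n → ℕ → Filling → Set
IsSkewSSYT N μ d F =
  (∀ p → InSkew μ d p → 1 ≤ F p × F p < N) ×
  (∀ p → InSkew μ d p → InSkew μ d (right p) → F p ≤ F (right p)) ×
  (∀ p → InSkew μ d p → InSkew μ d (down p) → F p < F (down p))

InSdE : ∀ {n} → ℕ → Vec ℕ n → Vec ℕ n → ℕ → ℕ → Filling → Filling → Set
InSdE N ρ lam d e S T = IsSkewSSYT N ρ d S × IsSkewSSYT N lam e T

AgreeOn : ∀ {n} → Vec ℕ n → ℕ → Filling → Filling → Set
AgreeOn μ d F G = ∀ p → InSkew μ d p → F p ≡ G p

eqPos : Pos → Pos → Bool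
eqPos (a , b) (c , d) = (a ≡ᵇ c) ∧ (b ≡ᵇ d)

memb : Pos → List Pos → Bool
memb p U = any (eqPos p) U

_∈U_ : Pos → List Pos → Set
p ∈U U = T (memb p U)

-- T extended by the convention T_{1,j} = 0 for d < j ≤ e (0 = missing box):
-- entry 0 outside lam/e.
Tz : ∀ {n} → Vec ℕ n → ℕ → Filling → Filling
Tz lam e T p = if inSkew lam e p then T p else 0

-- S'_U : from T, add box (r,ρ_r) with entry S_{r,ρ_r} and take S on U.
-- (U always contains (r,ρ_r).)  Regarded as a filling of ρ/d.
S'U : ∀ {n} → Vec ℕ n → ℕ → Filling → Filling → List Pos → Filling
S'U lam e S T U p = if memb p U then S p else Tz lam e T p

-- T'_U : from S, remove (r,ρ_r) and take T on U \ {(r,ρ_r)}.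
-- Regarded as a filling of lam/d = (ρ/d) minus the box (r,ρ_r).
T'U : ∀ {n} → Vec ℕ n → ℕ → Filling → Filling → List Pos → Filling
T'U lam e S T U p = if memb p U then Tz lam e T p else S p

Adjacent : Pos → Pos → Set
Adjacent B C = (C ≡ right B ⊎ B ≡ right C) ⊎ (C ≡ down B ⊎ B ≡ down C)

-- Violation of the skew SSYT requirements between p and the box q directly
-- right of / below p, for a filling F of the diagram D (entries compared as
-- numbers, 0 included).
Viol : (Pos → Bool) → Filling → Pos → Pos → Set
Viol D F p q = T (D p) × T (D q) ×
  ((q ≡ right p × F q < F p) ⊎ (q ≡ down p × F q ≤ F p))

FailsAt : (Pos → Bool) → Filling → Pos → Pos → Set
FailsAt D F B C = Viol D F B C ⊎ Viol D F C B

EitherFails : ∀ {n} → Vec ℕ n → Vec ℕ n → ℕ → ℕ → Filling → Filling →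
              List Pos → Pos → Pos → Set
EitherFails ρ lam d e S T U B C =
  FailsAt (inSkew ρ d) (S'U lam e S T U) B C ⊎ FailsAt (inSkew lam d) (T'U lam e S T U) B C

Uk : Pos → List (Pos × Pos) → ℕ → List Pos
Uk B₀ tr k = B₀ ∷ map proj₁ (take k tr)

-- tr = ((B_1,C_1), …, (B_M,C_M)) is a spanning tree for (S , T),
-- where B₀ = (r , ρ_r).
IsSpanningTree : ∀ {n} → Vec ℕ n → Vec ℕ n → ℕ → ℕ → Pos →
                 Filling → Filling → List (Pos × Pos) → Set
IsSpanningTree ρ lam d e B₀ S T tr =
  (∀ (k : Fin (length tr)) →
     let B = proj₁ (List.lookup tr k)
         C = proj₂ (List.lookup tr k)
         U = Uk B₀ tr (toℕ k)
     in (InSkew ρ d B × ¬ (B ∈U U) × C ∈U U)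
        × Adjacent B C
        × EitherFails ρ lam d e S T U B C)
  × (∀ B C → let U = Uk B₀ tr (length tr) in
       InSkew ρ d B → ¬ (B ∈U U) → C ∈U U → Adjacent B C →
       ¬ EitherFails ρ lam d e S T U B C)

{-# OPTIONS --safe #-}
-- Let B₀ = (r, ρ_r) be the box of ρ missing from λ. Along a spanning tree for (S, T), every box
-- added after B₀ lies in λ/e and satisfies S ≤ T there (`Dominated`): a failure of S'_U or T'_U
-- on an edge leaving U either forces this or contradicts the row and column conditions of S and T.
-- Now let (S₁, T₁) and (S₂, T₂) have the same image. If the tree of (S₁, T₁) ever left U(S₂, T₂),
-- along an edge from C ∈ U(S₂, T₂) to B ∉ U(S₂, T₂), then on {B, C} the failing filling S'₁ or T'₁
-- would coincide with S₂ or T₂, which are SSYT. Hence U(S₁, T₁) = U(S₂, T₂), and on a common U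
-- the swap is undone box by box.
module Submission where

open import Defs
open import Data.Bool using (Bool; true; false; T)
open import Data.Bool.Properties using (T-∧)
open import Data.Empty using (⊥-elim)
open import Data.Fin using (Fin; toℕ; zero; suc)
open import Data.Fin.Properties using (toℕ<n)
open import Data.List as List using (List; []; _∷_; length; take; map)
open import Data.List.Membership.Propositional using (_∈_)
open import Data.List.Relation.Unary.Any as Any using (here; there)
open import Data.List.Relation.Unary.Any.Properties using (any⁺; any⁻)
open import Data.Nat using (ℕ; zero; suc; _≤_; _<_; _+_; z≤n; s≤s)
open import Data.Nat.Properties
  using (_≟_; +-comm; ≤-trans; ≤-reflexive; <⇒≤; ≤-<-trans; <-irrefl; ≤⇒≯; <⇒≱; ≤∧≢⇒<; ≤-pred;
         n≤1+n; n<1+n; 1+n≢n; m<n⇒m<1+n; ≤ᵇ-reflects-≤; <ᵇ-reflects-<; ≡ᵇ⇒≡; ≡⇒≡ᵇ; module ≤-Reasoning)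
open import Data.Product using (Σ-syntax; _×_; _,_; proj₁; proj₂)
open import Data.Sum as Sum using (_⊎_; inj₁; inj₂; map₂)
open import Data.Unit using (tt)
open import Data.Vec using (Vec; lookup; []; _∷_)
open import Function using (_∘_; Equivalence)
open import Relation.Binary.PropositionalEquality
  using (_≡_; _≢_; refl; sym; trans; cong; cong₂; subst; subst₂; module ≡-Reasoning)
open import Relation.Nullary using (¬_; yes; no)
open import Relation.Nullary.Decidable using (T?)
open import Relation.Nullary.Reflects
  using (Reflects; ofʸ; ofⁿ; _×-reflects_; _⊎-reflects_; ¬-reflects; fromEquivalence)

SkewCell : ∀ {n} → Vec ℕ n → ℕ → Pos → Set
SkewCell μ d (i , j) = 1 ≤ i × 1 ≤ j × j ≤ row μ i × (i ≢ 1 ⊎ d < j)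

skewCell-reflects : ∀ {n} (μ : Vec ℕ n) d p → Reflects (SkewCell μ d p) (inSkew μ d p)
skewCell-reflects μ d (i , j) =
  (≤ᵇ-reflects-≤ 1 i ×-reflects ≤ᵇ-reflects-≤ 1 j ×-reflects ≤ᵇ-reflects-≤ j (row μ i) ×-reflects
   (¬-reflects (fromEquivalence (≡ᵇ⇒≡ i 1) (≡⇒≡ᵇ i 1)) ⊎-reflects <ᵇ-reflects-< d j))

module _ {n} (μ : Vec ℕ n) (d : ℕ) (p : Pos) where

  InSkew⇒SkewCell : InSkew μ d p → SkewCell μ d p
  InSkew⇒SkewCell with inSkew μ d p | skewCell-reflects μ d p
  ... | true | ofʸ cell = λ _ → cell

  SkewCell⇒InSkew : SkewCell μ d p → InSkew μ d p
  SkewCell⇒InSkew with inSkew μ d p | skewCell-reflects μ d p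
  ... | true  | _        = λ _ → tt
  ... | false | ofⁿ ¬cell = ¬cell

module _ {n} {μ : Vec ℕ n} where

  skew-⊆-offset : ∀ {d e} → d ≤ e → ∀ p → InSkew μ e p → InSkew μ d p
  skew-⊆-offset {d} {e} d≤e p p∈ with InSkew⇒SkewCell μ e p p∈
  ... | i≥1 , j≥1 , j≤μᵢ , offset =
    SkewCell⇒InSkew μ d p (i≥1 , j≥1 , j≤μᵢ , map₂ (≤-<-trans d≤e) offset)

  skew-⊆-rows : ∀ {ν : Vec ℕ n} {d} → (∀ i → row μ i ≤ row ν i) → ∀ p → InSkew μ d p → InSkew ν d p
  skew-⊆-rows {ν} {d} μ≤ν (i , j) p∈ with InSkew⇒SkewCell μ d (i , j) p∈
  ... | i≥1 , j≥1 , j≤μᵢ , offset =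
    SkewCell⇒InSkew ν d (i , j) (i≥1 , j≥1 , ≤-trans j≤μᵢ (μ≤ν i) , offset)

  skew-right-closed : ∀ {d e} p → InSkew μ e p → InSkew μ d (right p) → InSkew μ e (right p)
  skew-right-closed {d} {e} p p∈ q∈
    with InSkew⇒SkewCell μ e p p∈ | InSkew⇒SkewCell μ d (right p) q∈
  ... | i≥1 , _ , _ , offset | _ , j+1≥1 , j+1≤μᵢ , _ =
    SkewCell⇒InSkew μ e (right p) (i≥1 , j+1≥1 , j+1≤μᵢ , map₂ m<n⇒m<1+n offset)

  skew-down-closed : ∀ {d e} p → InSkew μ e p → InSkew μ d (down p) → InSkew μ e (down p)
  skew-down-closed {d} {e} p p∈ q∈
    with InSkew⇒SkewCell μ e p p∈ | InSkew⇒SkewCell μ d (down p) q∈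
  ... | s≤s z≤n , _ , _ , _ | i+1≥1 , j≥1 , j≤μᵢ₊₁ , _ =
    SkewCell⇒InSkew μ e (down p) (i+1≥1 , j≥1 , j≤μᵢ₊₁ , inj₁ λ ())

record RemovedCorner {n} (ρ lam : Vec ℕ n) (d e : ℕ) (B₀ : Pos) : Set where
  field
    offset-≤     : d ≤ e
    lam/e⊆ρ/e    : ∀ p → InSkew lam e p → InSkew ρ e p
    ρ/d-B₀⊆lam/d : ∀ p → InSkew ρ d p → p ≢ B₀ → InSkew lam d p
    B₀∈ρ/e       : InSkew ρ e B₀
    B₀∉lam/d     : ¬ InSkew lam d B₀
    right-B₀∉ρ/d : ¬ InSkew ρ d (right B₀)
    down-B₀∉ρ/d  : ¬ InSkew ρ d (down B₀)

row-lookup : ∀ {n} (μ : Vec ℕ n) f → row μ (suc (toℕ f)) ≡ lookup μ f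
row-lookup (_ ∷ _) zero    = refl
row-lookup (_ ∷ μ) (suc f) = row-lookup μ f

row-index : ∀ {n} i → (Σ[ f ∈ Fin n ] i ≡ suc (toℕ f)) ⊎ (∀ (μ : Vec ℕ n) → row μ i ≡ 0)
row-index zero = inj₂ λ _ → refl
row-index {zero}  (suc i) = inj₂ λ { [] → refl }
row-index {suc n} (suc zero) = inj₁ (zero , refl)
row-index {suc n} (suc (suc i)) with row-index {n} (suc i)
... | inj₁ (f , i≡f) = inj₁ (suc f , cong suc i≡f)
... | inj₂ beyond    = inj₂ λ { (_ ∷ μ) → beyond μ }

row-antitone : ∀ {n} (μ : Vec ℕ n) → IsPartition μ → ∀ i → row μ (suc (suc i)) ≤ row μ (suc i)
row-antitone []          _    _       = z≤n
row-antitone (_ ∷ [])    _    _       = z≤n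
row-antitone (_ ∷ _ ∷ _) part zero    = part zero (suc zero) z≤n
row-antitone (_ ∷ μ)     part (suc i) = row-antitone μ (λ a b a≤b → part (suc a) (suc b) (s≤s a≤b)) i

module OneBoxRemoved {n} (ρ lam : Vec ℕ n) (r : Fin n)
  (lam-r : lookup lam r + 1 ≡ lookup ρ r)
  (lam-i : ∀ i → i ≢ r → lookup lam i ≡ lookup ρ i) where

  R : ℕ
  R = suc (toℕ r)

  B₀ : Pos
  B₀ = (R , lookup ρ r)

  row-removed : lookup ρ r ≡ suc (row lam R)
  row-removed = begin
    lookup ρ r          ≡⟨ lam-r ⟨
    lookup lam r + 1    ≡⟨ +-comm (lookup lam r) 1 ⟩
    suc (lookup lam r)  ≡⟨ cong suc (row-lookup lam r) ⟨
    suc (row lam R)     ∎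
    where open ≡-Reasoning

  row-other : ∀ i → i ≢ R → row lam i ≡ row ρ i
  row-other i i≢R with row-index i
  ... | inj₂ beyond = trans (beyond lam) (sym (beyond ρ))
  ... | inj₁ (f , refl) = begin
    row lam (suc (toℕ f)) ≡⟨ row-lookup lam f ⟩
    lookup lam f          ≡⟨ lam-i f (λ f≡r → i≢R (cong (suc ∘ toℕ) f≡r)) ⟩
    lookup ρ f            ≡⟨ row-lookup ρ f ⟨
    row ρ (suc (toℕ f))   ∎
    where open ≡-Reasoning

  row-≤ : ∀ i → row lam i ≤ row ρ i
  row-≤ i with i ≟ R
  ... | yes refl = subst (row lam R ≤_) (trans (sym row-removed) (sym (row-lookup ρ r))) (n≤1+n _)
  ... | no i≢R   = ≤-reflexive (row-other i i≢R)

  removedCorner : IsPartition lam → ∀ {d e} → d ≤ e → e ≤ row lam 1 → RemovedCorner ρ lam d e B₀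
  removedCorner lam-part {d} {e} d≤e e≤lam₁ = record
    { offset-≤     = d≤e
    ; lam/e⊆ρ/e    = skew-⊆-rows row-≤
    ; ρ/d-B₀⊆lam/d = ρ/d-B₀⊆lam/d
    ; B₀∈ρ/e       = B₀∈ρ/e
    ; B₀∉lam/d     = B₀∉lam/d
    ; right-B₀∉ρ/d = right-B₀∉ρ/d
    ; down-B₀∉ρ/d  = down-B₀∉ρ/d
    }
    where
    open ≤-Reasoning

    row-R : row ρ R ≡ lookup ρ r
    row-R = row-lookup ρ r

    ρ/d-B₀⊆lam/d : ∀ p → InSkew ρ d p → p ≢ B₀ → InSkew lam d p
    ρ/d-B₀⊆lam/d (i , j) p∈ p≢B₀ with InSkew⇒SkewCell ρ d (i , j) p∈ | i ≟ R
    ... | i≥1 , j≥1 , j≤ρᵢ , offset | no i≢R =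
      SkewCell⇒InSkew lam d (i , j) (i≥1 , j≥1 , subst (j ≤_) (sym (row-other i i≢R)) j≤ρᵢ , offset)
    ... | i≥1 , j≥1 , j≤ρᵢ , offset | yes refl =
      SkewCell⇒InSkew lam d (i , j) (i≥1 , j≥1 , ≤-pred j<ρᵣ , offset)
      where
      j<ρᵣ : j < suc (row lam R)
      j<ρᵣ = ≤∧≢⇒< (subst (j ≤_) (trans row-R row-removed) j≤ρᵢ)
                   (λ j≡ρᵣ → p≢B₀ (cong (R ,_) (trans j≡ρᵣ (sym row-removed))))

    B₀∈ρ/e : InSkew ρ e B₀
    B₀∈ρ/e = SkewCell⇒InSkew ρ e B₀
      (s≤s z≤n , subst (1 ≤_) (sym row-removed) (s≤s z≤n) , ≤-reflexive (sym row-R) , offset)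
      where
      offset : R ≢ 1 ⊎ e < lookup ρ r
      offset with R ≟ 1
      ... | no R≢1  = inj₁ R≢1
      ... | yes R≡1 =
        inj₂ (subst (e <_) (sym row-removed) (s≤s (subst (λ i → e ≤ row lam i) (sym R≡1) e≤lam₁)))

    B₀∉lam/d : ¬ InSkew lam d B₀
    B₀∉lam/d B₀∈ with InSkew⇒SkewCell lam d B₀ B₀∈
    ... | _ , _ , ρᵣ≤lam , _ = <-irrefl refl (subst (_≤ row lam R) row-removed ρᵣ≤lam)

    right-B₀∉ρ/d : ¬ InSkew ρ d (right B₀)
    right-B₀∉ρ/d B∈ with InSkew⇒SkewCell ρ d (right B₀) B∈
    ... | _ , _ , ρᵣ<ρ , _ = <-irrefl refl (subst (lookup ρ r <_) row-R ρᵣ<ρ)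

    down-B₀∉ρ/d : ¬ InSkew ρ d (down B₀)
    down-B₀∉ρ/d B∈ with InSkew⇒SkewCell ρ d (down B₀) B∈
    ... | _ , _ , ρᵣ≤ρ , _ = <-irrefl refl (begin-strict
      row lam R          <⟨ n<1+n _ ⟩
      suc (row lam R)    ≡⟨ row-removed ⟨
      lookup ρ r         ≤⟨ ρᵣ≤ρ ⟩
      row ρ (suc R)      ≡⟨ row-other (suc R) 1+n≢n ⟨
      row lam (suc R)    ≤⟨ row-antitone lam lam-part (toℕ r) ⟩
      row lam R          ∎)

eqPos⇒≡ : ∀ p q → T (eqPos p q) → p ≡ q
eqPos⇒≡ (a , b) (c , d) a,b≡ᵇc,d with Equivalence.to T-∧ a,b≡ᵇc,d
... | a≡ᵇc , b≡ᵇd = cong₂ _,_ (≡ᵇ⇒≡ a c a≡ᵇc) (≡ᵇ⇒≡ b d b≡ᵇd)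

eqPos-refl : ∀ p → T (eqPos p p)
eqPos-refl (a , b) = Equivalence.from T-∧ (≡⇒≡ᵇ a a refl , ≡⇒≡ᵇ b b refl)

∈U⇒∈ : ∀ p U → p ∈U U → p ∈ U
∈U⇒∈ p U = Any.map (eqPos⇒≡ p _) ∘ any⁻ (eqPos p) U

∈⇒∈U : ∀ p U → p ∈ U → p ∈U U
∈⇒∈U p _ = any⁺ (eqPos p) ∘ Any.map (λ { refl → eqPos-refl p })

∈-take-suc : ∀ (tr : List (Pos × Pos)) k {p} → p ∈ map proj₁ (take (suc k) tr) →
  p ∈ map proj₁ (take k tr) ⊎ Σ[ f ∈ Fin (length tr) ] toℕ f ≡ k × p ≡ proj₁ (List.lookup tr f)
∈-take-suc (_ ∷ _)  zero    (here p≡)  = inj₂ (zero , refl , p≡)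
∈-take-suc (_ ∷ _)  (suc k) (here p≡)  = inj₁ (here p≡)
∈-take-suc (_ ∷ tr) (suc k) (there p∈) =
  Sum.map there (λ (f , f≡k , p≡) → suc f , cong suc f≡k , p≡) (∈-take-suc tr k p∈)

∈-take-mono : ∀ (tr : List (Pos × Pos)) {k m p} → k ≤ m →
  p ∈ map proj₁ (take k tr) → p ∈ map proj₁ (take m tr)
∈-take-mono (_ ∷ _)  (s≤s _)   (here p≡)  = here p≡
∈-take-mono (_ ∷ tr) (s≤s k≤m) (there p∈) = there (∈-take-mono tr k≤m p∈)

lookup-∈-take-length : ∀ (tr : List (Pos × Pos)) f →
  proj₁ (List.lookup tr f) ∈ map proj₁ (take (length tr) tr)
lookup-∈-take-length (_ ∷ _)  zero    = here refl
lookup-∈-take-length (_ ∷ tr) (suc f) = there (lookup-∈-take-length tr f)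

module _ (B₀ : Pos) (tr : List (Pos × Pos)) where

  B₀∈Uk : ∀ k → B₀ ∈U Uk B₀ tr k
  B₀∈Uk k = ∈⇒∈U B₀ (Uk B₀ tr k) (here refl)

  Uk-mono : ∀ {k m} p → k ≤ m → p ∈U Uk B₀ tr k → p ∈U Uk B₀ tr m
  Uk-mono {k} {m} p k≤m p∈ with ∈U⇒∈ p (Uk B₀ tr k) p∈
  ... | here p≡B₀ = ∈⇒∈U p (Uk B₀ tr m) (here p≡B₀)
  ... | there p∈ₖ = ∈⇒∈U p (Uk B₀ tr m) (there (∈-take-mono tr k≤m p∈ₖ))

  Bₖ∈U : ∀ f → proj₁ (List.lookup tr f) ∈U Uk B₀ tr (length tr)
  Bₖ∈U f = ∈⇒∈U _ (Uk B₀ tr (length tr)) (there (lookup-∈-take-length tr f))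

  Uk-induction : (P : Pos → Set) → P B₀ →
    (∀ f → (∀ p → p ∈U Uk B₀ tr (toℕ f) → P p) → P (proj₁ (List.lookup tr f))) →
    ∀ k p → p ∈U Uk B₀ tr k → P p
  Uk-induction P P-B₀ P-step k p = go k ∘ ∈U⇒∈ p (Uk B₀ tr k)
    where
    go : ∀ k {p} → p ∈ Uk B₀ tr k → P p
    go _       (here refl) = P-B₀
    go (suc k) (there p∈) with ∈-take-suc tr k p∈
    ... | inj₁ p∈ₖ              = go k (there p∈ₖ)
    ... | inj₂ (f , refl , refl) = P-step f (λ q → go (toℕ f) ∘ ∈U⇒∈ q (Uk B₀ tr (toℕ f)))

module _ {n} (lam : Vec ℕ n) (e : ℕ) (T : Filling) (p : Pos) where

  Tz-∈ : InSkew lam e p → Tz lam e T p ≡ T p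
  Tz-∈ p∈ with inSkew lam e p
  ... | true = refl

  Tz-positive : 1 ≤ Tz lam e T p → InSkew lam e p
  Tz-positive Tz≥1 with inSkew lam e p
  ... | true  = tt
  ... | false with () ← Tz≥1

module Swap {n} (lam : Vec ℕ n) (e : ℕ) (S T : Filling) (U : List Pos) (p : Pos) where

  S'-∈ : p ∈U U → S'U lam e S T U p ≡ S p
  S'-∈ p∈ with memb p U | p∈
  ... | true  | _  = refl
  ... | false | ()

  S'-∉ : ¬ p ∈U U → S'U lam e S T U p ≡ Tz lam e T p
  S'-∉ p∉ with memb p U | p∉
  ... | true  | p∉ = ⊥-elim (p∉ tt)
  ... | false | _  = refl

  T'-∈ : p ∈U U → T'U lam e S T U p ≡ Tz lam e T p
  T'-∈ p∈ with memb p U | p∈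
  ... | true  | _  = refl
  ... | false | ()

  T'-∉ : ¬ p ∈U U → T'U lam e S T U p ≡ S p
  T'-∉ p∉ with memb p U | p∉
  ... | true  | p∉ = ⊥-elim (p∉ tt)
  ... | false | _  = refl

module _ (D : Pos → Bool) {F G : Filling} where

  Viol-cong : ∀ {p q} → F p ≡ G p → F q ≡ G q → Viol D F p q → Viol D G p q
  Viol-cong Fp≡ Fq≡ (p∈ , q∈ , inj₁ (q≡ , Fq<Fp)) = p∈ , q∈ , inj₁ (q≡ , subst₂ _<_ Fq≡ Fp≡ Fq<Fp)
  Viol-cong Fp≡ Fq≡ (p∈ , q∈ , inj₂ (q≡ , Fq≤Fp)) = p∈ , q∈ , inj₂ (q≡ , subst₂ _≤_ Fq≡ Fp≡ Fq≤Fp)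

  FailsAt-cong : ∀ {B C} → F B ≡ G B → F C ≡ G C → FailsAt D F B C → FailsAt D G B C
  FailsAt-cong FB≡ FC≡ = Sum.map (Viol-cong FB≡ FC≡) (Viol-cong FC≡ FB≡)

FailsAt⇒∈ : ∀ (D : Pos → Bool) {F B C} → FailsAt D F B C → T (D B) × T (D C)
FailsAt⇒∈ _ (inj₁ (B∈ , C∈ , _)) = B∈ , C∈
FailsAt⇒∈ _ (inj₂ (C∈ , B∈ , _)) = B∈ , C∈

FailsAt-restrict : ∀ (D D′ : Pos → Bool) {F B C} → T (D′ B) → T (D′ C) → FailsAt D F B C → FailsAt D′ F B C
FailsAt-restrict _ _ B∈ C∈ (inj₁ (_ , _ , bad)) = inj₁ (B∈ , C∈ , bad)
FailsAt-restrict _ _ B∈ C∈ (inj₂ (_ , _ , bad)) = inj₂ (C∈ , B∈ , bad)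

module _ {N n} {μ : Vec ℕ n} {c : ℕ} {F : Filling} (F-ssyt : IsSkewSSYT N μ c F) where

  SSYT-¬Viol : ∀ {p q} → ¬ Viol (inSkew μ c) F p q
  SSYT-¬Viol (p∈ , q∈ , inj₁ (refl , Fq<Fp)) = ≤⇒≯ (proj₁ (proj₂ F-ssyt) _ p∈ q∈) Fq<Fp
  SSYT-¬Viol (p∈ , q∈ , inj₂ (refl , Fq≤Fp)) = <⇒≱ (proj₂ (proj₂ F-ssyt) _ p∈ q∈) Fq≤Fp

  SSYT-¬FailsAt : ∀ {B C} → ¬ FailsAt (inSkew μ c) F B C
  SSYT-¬FailsAt = Sum.[ SSYT-¬Viol , SSYT-¬Viol ]

module SwapInjectivity (N : ℕ) {n} {ρ lam : Vec ℕ n} {d e : ℕ} {B₀ : Pos}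
  (removed-corner : RemovedCorner ρ lam d e B₀) where

  open RemovedCorner removed-corner

  data Dominated (S T : Filling) : Pos → Set where
    corner    : Dominated S T B₀
    dominated : ∀ {p} → InSkew lam e p → S p ≤ T p → Dominated S T p

  Dominated⇒ρ/e : ∀ {S T} p → Dominated S T p → InSkew ρ e p
  Dominated⇒ρ/e _ corner              = B₀∈ρ/e
  Dominated⇒ρ/e p (dominated p∈λe _) = lam/e⊆ρ/e p p∈λe

  Dominated⇒λ/e : ∀ {S T} p → Dominated S T p → InSkew lam d p → InSkew lam e p
  Dominated⇒λ/e _ corner              B₀∈λd = ⊥-elim (B₀∉lam/d B₀∈λd)
  Dominated⇒λ/e _ (dominated p∈λe _) _     = p∈λe

  λ/e⊆ρ/d : ∀ p → InSkew lam e p → InSkew ρ d p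
  λ/e⊆ρ/d p = skew-⊆-offset offset-≤ p ∘ lam/e⊆ρ/e p

  module _ {S T : Filling} (S-ssyt : IsSkewSSYT N ρ d S) (T-ssyt : IsSkewSSYT N lam e T) where

    open ≤-Reasoning

    private
      S-positive : ∀ p → InSkew ρ d p → 1 ≤ S p
      S-positive p p∈ = proj₁ (proj₁ S-ssyt p p∈)

      S-row : ∀ p → InSkew ρ d p → InSkew ρ d (right p) → S p ≤ S (right p)
      S-row = proj₁ (proj₂ S-ssyt)

      S-col : ∀ p → InSkew ρ d p → InSkew ρ d (down p) → S p < S (down p)
      S-col = proj₂ (proj₂ S-ssyt)

      T-row : ∀ p → InSkew lam e p → InSkew lam e (right p) → T p ≤ T (right p)
      T-row = proj₁ (proj₂ T-ssyt)

      T-col : ∀ p → InSkew lam e p → InSkew lam e (down p) → T p < T (down p)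
      T-col = proj₂ (proj₂ T-ssyt)

    -- F stands for S'_U with B ∉ U ∋ C; only its values at B and C matter.
    S'-failure-dominated : ∀ {F B C} → F B ≡ Tz lam e T B → F C ≡ S C → B ≢ B₀ →
      Dominated S T C → FailsAt (inSkew ρ d) F B C → Dominated S T B
    S'-failure-dominated {B = B} FB≡ FC≡ _ _ (inj₁ (B∈ρd , C∈ρd , inj₁ (refl , FC<FB))) =
      dominated B∈λe (begin
        S B                     ≤⟨ S-row B B∈ρd C∈ρd ⟩
        S (right B)             ≤⟨ <⇒≤ SC<TzB ⟩
        Tz lam e T B            ≡⟨ Tz-∈ lam e T B B∈λe ⟩
        T B                     ∎)
      where
      SC<TzB : S (right B) < Tz lam e T B
      SC<TzB = subst₂ _<_ FC≡ FB≡ FC<FB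
      B∈λe : InSkew lam e B
      B∈λe = Tz-positive lam e T B (≤-trans (S-positive (right B) C∈ρd) (<⇒≤ SC<TzB))
    S'-failure-dominated {B = B} FB≡ FC≡ _ _ (inj₁ (B∈ρd , C∈ρd , inj₂ (refl , FC≤FB))) =
      dominated B∈λe (<⇒≤ (begin-strict
        S B                     <⟨ S-col B B∈ρd C∈ρd ⟩
        S (down B)              ≤⟨ SC≤TzB ⟩
        Tz lam e T B            ≡⟨ Tz-∈ lam e T B B∈λe ⟩
        T B                     ∎))
      where
      SC≤TzB : S (down B) ≤ Tz lam e T B
      SC≤TzB = subst₂ _≤_ FC≡ FB≡ FC≤FB
      B∈λe : InSkew lam e B
      B∈λe = Tz-positive lam e T B (≤-trans (S-positive (down B) C∈ρd) SC≤TzB)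
    S'-failure-dominated _ _ _ corner (inj₂ (_ , B∈ρd , inj₁ (refl , _))) = ⊥-elim (right-B₀∉ρ/d B∈ρd)
    S'-failure-dominated _ _ _ corner (inj₂ (_ , B∈ρd , inj₂ (refl , _))) = ⊥-elim (down-B₀∉ρ/d B∈ρd)
    S'-failure-dominated {F} {C = C} FB≡ FC≡ B≢B₀ (dominated C∈λe SC≤TC)
                         (inj₂ (_ , B∈ρd , inj₁ (refl , FB<FC))) =
      ⊥-elim (<-irrefl refl (begin-strict
        T C                       ≤⟨ T-row C C∈λe B∈λe ⟩
        T (right C)               ≡⟨ Tz-∈ lam e T (right C) B∈λe ⟨
        Tz lam e T (right C)      ≡⟨ FB≡ ⟨
        F (right C)               <⟨ FB<FC ⟩
        F C                       ≡⟨ FC≡ ⟩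
        S C                       ≤⟨ SC≤TC ⟩
        T C                       ∎))
      where
      B∈λe : InSkew lam e (right C)
      B∈λe = skew-right-closed {d = d} C C∈λe (ρ/d-B₀⊆lam/d _ B∈ρd B≢B₀)
    S'-failure-dominated {F} {C = C} FB≡ FC≡ B≢B₀ (dominated C∈λe SC≤TC)
                         (inj₂ (_ , B∈ρd , inj₂ (refl , FB≤FC))) =
      ⊥-elim (<-irrefl refl (begin-strict
        T C                       <⟨ T-col C C∈λe B∈λe ⟩
        T (down C)                ≡⟨ Tz-∈ lam e T (down C) B∈λe ⟨
        Tz lam e T (down C)       ≡⟨ FB≡ ⟨
        F (down C)                ≤⟨ FB≤FC ⟩
        F C                       ≡⟨ FC≡ ⟩
        S C                       ≤⟨ SC≤TC ⟩
        T C                       ∎))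
      where
      B∈λe : InSkew lam e (down C)
      B∈λe = skew-down-closed {d = d} C C∈λe (ρ/d-B₀⊆lam/d _ B∈ρd B≢B₀)

    T'-failure-dominated : ∀ {F B C} → F B ≡ S B → F C ≡ Tz lam e T C → InSkew ρ d B →
      Dominated S T C → FailsAt (inSkew lam d) F B C → Dominated S T B
    T'-failure-dominated _ _ _ corner (inj₁ (_ , C∈λd , _)) = ⊥-elim (B₀∉lam/d C∈λd)
    T'-failure-dominated _ _ _ corner (inj₂ (C∈λd , _ , _)) = ⊥-elim (B₀∉lam/d C∈λd)
    T'-failure-dominated {F} {B} FB≡ FC≡ B∈ρd (dominated C∈λe SC≤TC) (inj₁ (_ , _ , inj₁ (refl , FC<FB))) =
      ⊥-elim (<-irrefl refl (begin-strict
        S B                     ≤⟨ S-row B B∈ρd (λ/e⊆ρ/d (right B) C∈λe) ⟩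
        S (right B)             ≤⟨ SC≤TC ⟩
        T (right B)             ≡⟨ Tz-∈ lam e T (right B) C∈λe ⟨
        Tz lam e T (right B)    ≡⟨ FC≡ ⟨
        F (right B)             <⟨ FC<FB ⟩
        F B                     ≡⟨ FB≡ ⟩
        S B                     ∎))
    T'-failure-dominated {F} {B} FB≡ FC≡ B∈ρd (dominated C∈λe SC≤TC) (inj₁ (_ , _ , inj₂ (refl , FC≤FB))) =
      ⊥-elim (<-irrefl refl (begin-strict
        S B                     <⟨ S-col B B∈ρd (λ/e⊆ρ/d (down B) C∈λe) ⟩
        S (down B)              ≤⟨ SC≤TC ⟩
        T (down B)              ≡⟨ Tz-∈ lam e T (down B) C∈λe ⟨
        Tz lam e T (down B)     ≡⟨ FC≡ ⟨
        F (down B)              ≤⟨ FC≤FB ⟩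
        F B                     ≡⟨ FB≡ ⟩
        S B                     ∎))
    T'-failure-dominated {F} {C = C} FB≡ FC≡ _ (dominated C∈λe _) (inj₂ (_ , B∈λd , inj₁ (refl , FB<FC))) =
      dominated B∈λe (<⇒≤ (begin-strict
        S (right C)             ≡⟨ FB≡ ⟨
        F (right C)             <⟨ FB<FC ⟩
        F C                     ≡⟨ FC≡ ⟩
        Tz lam e T C            ≡⟨ Tz-∈ lam e T C C∈λe ⟩
        T C                     ≤⟨ T-row C C∈λe B∈λe ⟩
        T (right C)             ∎))
      where
      B∈λe : InSkew lam e (right C)
      B∈λe = skew-right-closed {d = d} C C∈λe B∈λd
    T'-failure-dominated {F} {C = C} FB≡ FC≡ _ (dominated C∈λe _) (inj₂ (_ , B∈λd , inj₂ (refl , FB≤FC))) =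
      dominated B∈λe (<⇒≤ (begin-strict
        S (down C)              ≡⟨ FB≡ ⟨
        F (down C)              ≤⟨ FB≤FC ⟩
        F C                     ≡⟨ FC≡ ⟩
        Tz lam e T C            ≡⟨ Tz-∈ lam e T C C∈λe ⟩
        T C                     <⟨ T-col C C∈λe B∈λe ⟩
        T (down C)              ∎))
      where
      B∈λe : InSkew lam e (down C)
      B∈λe = skew-down-closed {d = d} C C∈λe B∈λd

    failure-dominated : ∀ U B C → InSkew ρ d B → ¬ B ∈U U → C ∈U U → B ≢ B₀ →
      Dominated S T C → EitherFails ρ lam d e S T U B C → Dominated S T B
    failure-dominated U B C B∈ρd B∉ C∈ B≢B₀ C-dom = Sum.[
      S'-failure-dominated (Swap.S'-∉ lam e S T U B B∉) (Swap.S'-∈ lam e S T U C C∈) B≢B₀ C-dom ,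
      T'-failure-dominated (Swap.T'-∉ lam e S T U B B∉) (Swap.T'-∈ lam e S T U C C∈) B∈ρd C-dom ]

    tree-dominated : ∀ {tr} → IsSpanningTree ρ lam d e B₀ S T tr →
      ∀ p → p ∈U Uk B₀ tr (length tr) → Dominated S T p
    tree-dominated {tr} (grows , _) = Uk-induction B₀ tr (Dominated S T) corner step (length tr)
      where
      step : ∀ f → (∀ p → p ∈U Uk B₀ tr (toℕ f) → Dominated S T p) →
        Dominated S T (proj₁ (List.lookup tr f))
      step f IH with grows f
      ... | (B∈ρd , B∉ , C∈) , _ , fails =
        failure-dominated (Uk B₀ tr (toℕ f)) B C B∈ρd B∉ C∈
          (λ { refl → B∉ (B₀∈Uk B₀ tr (toℕ f)) }) (IH C C∈) fails
        where
        B C : Pos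
        B = proj₁ (List.lookup tr f)
        C = proj₂ (List.lookup tr f)

  record SameImage (S₁ T₁ : Filling) (U₁ : List Pos) (S₂ T₂ : Filling) (U₂ : List Pos) : Set where
    constructor sameImage
    field
      S'-agree : AgreeOn ρ e (S'U lam e S₁ T₁ U₁) (S'U lam e S₂ T₂ U₂)
      T'-agree : AgreeOn lam d (T'U lam e S₁ T₁ U₁) (T'U lam e S₂ T₂ U₂)

  SameImage-sym : ∀ {S₁ T₁ U₁ S₂ T₂ U₂} → SameImage S₁ T₁ U₁ S₂ T₂ U₂ → SameImage S₂ T₂ U₂ S₁ T₁ U₁
  SameImage-sym (sameImage S'-agree T'-agree) =
    sameImage (λ p p∈ → sym (S'-agree p p∈)) (λ p p∈ → sym (T'-agree p p∈))

  module _ {S₁ T₁ S₂ T₂ : Filling} {U₁ U₂ : List Pos}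
    (S₂-ssyt : IsSkewSSYT N ρ d S₂) (T₂-ssyt : IsSkewSSYT N lam e T₂)
    (same : SameImage S₁ T₁ U₁ S₂ T₂ U₂) where

    open SameImage same

    edge-leaving-U₂-cannot-fail : ∀ V B C → ¬ B ∈U V → C ∈U V → B ∈U U₁ → C ∈U U₁ →
      ¬ B ∈U U₂ → C ∈U U₂ → InSkew lam e B → Dominated S₁ T₁ C → ¬ EitherFails ρ lam d e S₁ T₁ V B C
    edge-leaving-U₂-cannot-fail V B C B∉V C∈V B∈U₁ C∈U₁ B∉U₂ C∈U₂ B∈λe C-dom (inj₁ S'-fails) =
      SSYT-¬FailsAt S₂-ssyt (FailsAt-cong (inSkew ρ d) S'B≡ S'C≡ S'-fails)
      where
      open ≡-Reasoning
      S'B≡ : S'U lam e S₁ T₁ V B ≡ S₂ B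
      S'B≡ = begin
        S'U lam e S₁ T₁ V B    ≡⟨ Swap.S'-∉ lam e S₁ T₁ V B B∉V ⟩
        Tz lam e T₁ B          ≡⟨ Swap.T'-∈ lam e S₁ T₁ U₁ B B∈U₁ ⟨
        T'U lam e S₁ T₁ U₁ B   ≡⟨ T'-agree B (skew-⊆-offset offset-≤ B B∈λe) ⟩
        T'U lam e S₂ T₂ U₂ B   ≡⟨ Swap.T'-∉ lam e S₂ T₂ U₂ B B∉U₂ ⟩
        S₂ B                   ∎
      S'C≡ : S'U lam e S₁ T₁ V C ≡ S₂ C
      S'C≡ = begin
        S'U lam e S₁ T₁ V C    ≡⟨ Swap.S'-∈ lam e S₁ T₁ V C C∈V ⟩
        S₁ C                   ≡⟨ Swap.S'-∈ lam e S₁ T₁ U₁ C C∈U₁ ⟨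
        S'U lam e S₁ T₁ U₁ C   ≡⟨ S'-agree C (Dominated⇒ρ/e C C-dom) ⟩
        S'U lam e S₂ T₂ U₂ C   ≡⟨ Swap.S'-∈ lam e S₂ T₂ U₂ C C∈U₂ ⟩
        S₂ C                   ∎
    edge-leaving-U₂-cannot-fail V B C B∉V C∈V B∈U₁ C∈U₁ B∉U₂ C∈U₂ B∈λe C-dom (inj₂ T'-fails) =
      SSYT-¬FailsAt T₂-ssyt
        (FailsAt-restrict (inSkew lam d) (inSkew lam e) B∈λe C∈λe
          (FailsAt-cong (inSkew lam d) T'B≡ T'C≡ T'-fails))
      where
      open ≡-Reasoning
      C∈λe : InSkew lam e C
      C∈λe = Dominated⇒λ/e C C-dom (proj₂ (FailsAt⇒∈ (inSkew lam d) T'-fails))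
      T'B≡ : T'U lam e S₁ T₁ V B ≡ T₂ B
      T'B≡ = begin
        T'U lam e S₁ T₁ V B    ≡⟨ Swap.T'-∉ lam e S₁ T₁ V B B∉V ⟩
        S₁ B                   ≡⟨ Swap.S'-∈ lam e S₁ T₁ U₁ B B∈U₁ ⟨
        S'U lam e S₁ T₁ U₁ B   ≡⟨ S'-agree B (lam/e⊆ρ/e B B∈λe) ⟩
        S'U lam e S₂ T₂ U₂ B   ≡⟨ Swap.S'-∉ lam e S₂ T₂ U₂ B B∉U₂ ⟩
        Tz lam e T₂ B          ≡⟨ Tz-∈ lam e T₂ B B∈λe ⟩
        T₂ B                   ∎
      T'C≡ : T'U lam e S₁ T₁ V C ≡ T₂ C
      T'C≡ = begin
        T'U lam e S₁ T₁ V C    ≡⟨ Swap.T'-∈ lam e S₁ T₁ V C C∈V ⟩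
        Tz lam e T₁ C          ≡⟨ Swap.T'-∈ lam e S₁ T₁ U₁ C C∈U₁ ⟨
        T'U lam e S₁ T₁ U₁ C   ≡⟨ T'-agree C (skew-⊆-offset offset-≤ C C∈λe) ⟩
        T'U lam e S₂ T₂ U₂ C   ≡⟨ Swap.T'-∈ lam e S₂ T₂ U₂ C C∈U₂ ⟩
        Tz lam e T₂ C          ≡⟨ Tz-∈ lam e T₂ C C∈λe ⟩
        T₂ C                   ∎

  tree-⊆ : ∀ {S₁ T₁ S₂ T₂ tr₁ U₂} →
    IsSkewSSYT N ρ d S₁ → IsSkewSSYT N lam e T₁ → IsSkewSSYT N ρ d S₂ → IsSkewSSYT N lam e T₂ →
    IsSpanningTree ρ lam d e B₀ S₁ T₁ tr₁ → SameImage S₁ T₁ (Uk B₀ tr₁ (length tr₁)) S₂ T₂ U₂ →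
    B₀ ∈U U₂ → ∀ p → p ∈U Uk B₀ tr₁ (length tr₁) → p ∈U U₂
  tree-⊆ {tr₁ = tr₁} {U₂} S₁-ssyt T₁-ssyt S₂-ssyt T₂-ssyt tree₁@(grows , _) same B₀∈U₂ =
    Uk-induction B₀ tr₁ (_∈U U₂) B₀∈U₂ step (length tr₁)
    where
    step : ∀ f → (∀ p → p ∈U Uk B₀ tr₁ (toℕ f) → p ∈U U₂) → proj₁ (List.lookup tr₁ f) ∈U U₂
    step f IH with grows f | T? (memb (proj₁ (List.lookup tr₁ f)) U₂)
    ... | _ | yes B∈U₂ = B∈U₂
    ... | (B∈ρd , B∉V , C∈V) , _ , fails | no B∉U₂ =
      ⊥-elim (edge-leaving-U₂-cannot-fail S₂-ssyt T₂-ssyt same V B C B∉V C∈V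
                B∈U₁ C∈U₁ B∉U₂ (IH C C∈V) B∈λe (tree-dominated S₁-ssyt T₁-ssyt tree₁ C C∈U₁) fails)
      where
      V : List Pos
      V = Uk B₀ tr₁ (toℕ f)
      B C : Pos
      B = proj₁ (List.lookup tr₁ f)
      C = proj₂ (List.lookup tr₁ f)
      B∈U₁ : B ∈U Uk B₀ tr₁ (length tr₁)
      B∈U₁ = Bₖ∈U B₀ tr₁ f
      C∈U₁ : C ∈U Uk B₀ tr₁ (length tr₁)
      C∈U₁ = Uk-mono B₀ tr₁ C (<⇒≤ (toℕ<n f)) C∈V
      B∈λe : InSkew lam e B
      B∈λe = Dominated⇒λ/e B (tree-dominated S₁-ssyt T₁-ssyt tree₁ B B∈U₁)
               (ρ/d-B₀⊆lam/d B B∈ρd λ { refl → B∉V (B₀∈Uk B₀ tr₁ (toℕ f)) })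

  swap-injective : ∀ {S₁ T₁ S₂ T₂ U₁ U₂} → SameImage S₁ T₁ U₁ S₂ T₂ U₂ →
    (∀ p → p ∈U U₁ → p ∈U U₂) → (∀ p → p ∈U U₂ → p ∈U U₁) →
    B₀ ∈U U₁ → (∀ p → p ∈U U₁ → InSkew ρ e p) →
    AgreeOn ρ d S₁ S₂ × AgreeOn lam e T₁ T₂
  swap-injective {S₁} {T₁} {S₂} {T₂} {U₁} {U₂} (sameImage S'-agree T'-agree) U₁⊆U₂ U₂⊆U₁ B₀∈U₁ U₁⊆ρ/e =
    S-agree , T-agree
    where
    open ≡-Reasoning

    S-agree : AgreeOn ρ d S₁ S₂
    S-agree p p∈ρd with T? (memb p U₁)
    ... | yes p∈U₁ = begin
      S₁ p                   ≡⟨ Swap.S'-∈ lam e S₁ T₁ U₁ p p∈U₁ ⟨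
      S'U lam e S₁ T₁ U₁ p   ≡⟨ S'-agree p (U₁⊆ρ/e p p∈U₁) ⟩
      S'U lam e S₂ T₂ U₂ p   ≡⟨ Swap.S'-∈ lam e S₂ T₂ U₂ p (U₁⊆U₂ p p∈U₁) ⟩
      S₂ p                   ∎
    ... | no p∉U₁ = begin
      S₁ p                   ≡⟨ Swap.T'-∉ lam e S₁ T₁ U₁ p p∉U₁ ⟨
      T'U lam e S₁ T₁ U₁ p   ≡⟨ T'-agree p (ρ/d-B₀⊆lam/d p p∈ρd λ { refl → p∉U₁ B₀∈U₁ }) ⟩
      T'U lam e S₂ T₂ U₂ p   ≡⟨ Swap.T'-∉ lam e S₂ T₂ U₂ p (p∉U₁ ∘ U₂⊆U₁ p) ⟩
      S₂ p                   ∎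

    T-agree : AgreeOn lam e T₁ T₂
    T-agree p p∈λe with T? (memb p U₁)
    ... | yes p∈U₁ = begin
      T₁ p                   ≡⟨ Tz-∈ lam e T₁ p p∈λe ⟨
      Tz lam e T₁ p          ≡⟨ Swap.T'-∈ lam e S₁ T₁ U₁ p p∈U₁ ⟨
      T'U lam e S₁ T₁ U₁ p   ≡⟨ T'-agree p (skew-⊆-offset offset-≤ p p∈λe) ⟩
      T'U lam e S₂ T₂ U₂ p   ≡⟨ Swap.T'-∈ lam e S₂ T₂ U₂ p (U₁⊆U₂ p p∈U₁) ⟩
      Tz lam e T₂ p          ≡⟨ Tz-∈ lam e T₂ p p∈λe ⟩
      T₂ p                   ∎
    ... | no p∉U₁ = begin
      T₁ p                   ≡⟨ Tz-∈ lam e T₁ p p∈λe ⟨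
      Tz lam e T₁ p          ≡⟨ Swap.S'-∉ lam e S₁ T₁ U₁ p p∉U₁ ⟨
      S'U lam e S₁ T₁ U₁ p   ≡⟨ S'-agree p (lam/e⊆ρ/e p p∈λe) ⟩
      S'U lam e S₂ T₂ U₂ p   ≡⟨ Swap.S'-∉ lam e S₂ T₂ U₂ p (p∉U₁ ∘ U₂⊆U₁ p) ⟩
      Tz lam e T₂ p          ≡⟨ Tz-∈ lam e T₂ p p∈λe ⟩
      T₂ p                   ∎

  spanning-swap-injective : ∀ {S₁ T₁ S₂ T₂ tr₁ tr₂} →
    InSdE N ρ lam d e S₁ T₁ → InSdE N ρ lam d e S₂ T₂ →
    IsSpanningTree ρ lam d e B₀ S₁ T₁ tr₁ → IsSpanningTree ρ lam d e B₀ S₂ T₂ tr₂ →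
    SameImage S₁ T₁ (Uk B₀ tr₁ (length tr₁)) S₂ T₂ (Uk B₀ tr₂ (length tr₂)) →
    AgreeOn ρ d S₁ S₂ × AgreeOn lam e T₁ T₂
  spanning-swap-injective {tr₁ = tr₁} {tr₂} (S₁-ssyt , T₁-ssyt) (S₂-ssyt , T₂-ssyt) tree₁ tree₂ same =
    swap-injective same
      (tree-⊆ S₁-ssyt T₁-ssyt S₂-ssyt T₂-ssyt tree₁ same (B₀∈Uk B₀ tr₂ (length tr₂)))
      (tree-⊆ S₂-ssyt T₂-ssyt S₁-ssyt T₁-ssyt tree₂ (SameImage-sym same) (B₀∈Uk B₀ tr₁ (length tr₁)))
      (B₀∈Uk B₀ tr₁ (length tr₁))
      (λ p → Dominated⇒ρ/e p ∘ tree-dominated S₁-ssyt T₁-ssyt tree₁ p)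

proposition2p12 :
    (N n : ℕ) (ρ lam : Vec ℕ n) (r : Fin n) →
    1 ≤ n → n ≤ N →
    IsPartition ρ → IsPartition lam →
    lookup lam r + 1 ≡ lookup ρ r →
    (∀ (i : Fin n) → i ≢ r → lookup lam i ≡ lookup ρ i) →
    (d e : ℕ) → d < e → e ≤ row lam 1 →
    (S₁ T₁ S₂ T₂ : Filling) →
    InSdE N ρ lam d e S₁ T₁ → InSdE N ρ lam d e S₂ T₂ →
    (tr₁ tr₂ : List (Pos × Pos)) →
    IsSpanningTree ρ lam d e (suc (toℕ r) , lookup ρ r) S₁ T₁ tr₁ →
    IsSpanningTree ρ lam d e (suc (toℕ r) , lookup ρ r) S₂ T₂ tr₂ →
    AgreeOn ρ e (S'U lam e S₁ T₁ (Uk (suc (toℕ r) , lookup ρ r) tr₁ (length tr₁)))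
                (S'U lam e S₂ T₂ (Uk (suc (toℕ r) , lookup ρ r) tr₂ (length tr₂))) →
    AgreeOn lam d (T'U lam e S₁ T₁ (Uk (suc (toℕ r) , lookup ρ r) tr₁ (length tr₁)))
                  (T'U lam e S₂ T₂ (Uk (suc (toℕ r) , lookup ρ r) tr₂ (length tr₂))) →
    AgreeOn ρ d S₁ S₂ × AgreeOn lam e T₁ T₂
proposition2p12 N n ρ lam r _ _ _ lam-partition lam-r lam-i d e d<e e≤lam₁
                S₁ T₁ S₂ T₂ in-S₁ in-S₂ tr₁ tr₂ tree₁ tree₂ S'-agree T'-agree =
  spanning-swap-injective in-S₁ in-S₂ tree₁ tree₂ (sameImage S'-agree T'-agree)
  where
  open OneBoxRemoved ρ lam r lam-r lam-i using (removedCorner)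
  open SwapInjectivity N (removedCorner lam-partition (<⇒≤ d<e) e≤lam₁)
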